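{- For discrete containers $F$ and $G$ (i.e. all of their position types have decidable equality), the lax chain-rule morphism $\mathrm{chain}_{F,G}:(\partial F)[G]\times\partial G\multimap\partial(F[G])$ is an equivalence of containers. In particular, for set-truncated discrete $F,G$ it is an isomorphism in the 1-category of set-truncated containers.
   Context: Work in Homotopy Type Theory with a univalent universe. A point $a:A$ is isolated if $a=b$ is decidable for all $b:A$; $A^{\circ}$ is the subtype of isolated points and $A\setminus a:=\sum_{b:A}\neg(a=b)$. A container $(S\triangleleft P)$ has shapes $S:\mathsf{Type}$ and positions $P:S\to\mathsf{Type}$; it is discrete if each $P_s$ has decidable equality, set-truncated if $S$ and all $P_s$ are sets. A cartesian morphism $(S\triangleleft P)\multimap(T\triangleleft Q)$ is $(f,u)$ with $f:S\to T$, $u:\prod_sQ_{fs}\simeq P_s$; it is an equivalence of containers if $f$ is an equivalence. Product: $(S\triangleleft P)\times(T\triangleleft Q):=(S\times T\triangleleft\lambda(s,t).P_s+Q_t)$; substitution: $(S\triangleleft P)[(T\triangleleft Q)]:=((s,f):\sum_s(P_s\to T)\triangleleft\sum_{p:P_s}Q_{fp})$; derivative: $\partial(S\triangleleft P):=((s,p):\sum_s(P_s)^{\circ}\triangleleft P_s\setminus p)$. Grafting: for isolated $p_0:P_s$, $f:P_s\setminus p_0\to T$, $t:T$, $\mathrm{graft}(f,t):P_s\to T$ sends $p$ to $f(p,h)$ if $h:\neg(p_0=p)$ and to $t$ if $p_0=p$. For $F=(S\triangleleft P)$, $G=(T\triangleleft Q)$, $\mathrm{chain}_{F,G}$ has shape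 map $(((s,p_0),f),(t,q_0))\mapsto((s,\mathrm{graft}(f,t)),(p_0,q_0))$ (with $q_0$ transported along $\mathrm{graft}(f,t)(p_0)=t$; the pair is isolated), and position maps given by certain equivalences $(\sum_{p:P_s}Q_{\mathrm{graft}(f,t)(p)})\setminus(p_0,q_0)\simeq(\sum_{p:P_s\setminus p_0}Q_{fp})+(Q_t\setminus q_0)$. -}

module Defs where

open import Level using (Level; _⊔_)
open import Data.Product using (Σ; Σ-syntax; _×_; _,_; proj₁; proj₂)
open import Data.Sum using (_⊎_)
open import Data.Empty using (⊥-elim)
open import Relation.Nullary using (¬_; Dec; yes; no)
open import Relation.Binary.PropositionalEquality
  using (_≡_; refl; sym; trans; cong; subst; trans-symˡ)
open import Data.Container.Core using (Container; _▷_; Shape; Position)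

private variable ℓ ℓ' : Level

isContr : Set ℓ → Set ℓ
isContr A = Σ A (λ c → ∀ x → c ≡ x)

fiber : {A : Set ℓ} {B : Set ℓ'} → (A → B) → B → Set (ℓ ⊔ ℓ')
fiber {A = A} f y = Σ A (λ x → f x ≡ y)

isEquiv : {A : Set ℓ} {B : Set ℓ'} → (A → B) → Set (ℓ ⊔ ℓ')
isEquiv {B = B} f = ∀ (y : B) → isContr (fiber f y)

isIsolated : {A : Set ℓ} → A → Set ℓ
isIsolated {A = A} a = ∀ (b : A) → Dec (a ≡ b)

_° : Set ℓ → Set ℓ
A ° = Σ A isIsolated

_∖_ : (A : Set ℓ) → A → Set ℓ
A ∖ a = Σ A (λ b → ¬ (a ≡ b))

module LocalHedberg {A : Set ℓ} {a : A} (iso : isIsolated a) where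
  private
    c : ∀ {x} → a ≡ x → a ≡ x
    c {x} p with iso x
    ... | yes q = q
    ... | no h = ⊥-elim (h p)

    c-const : ∀ {x} (p q : a ≡ x) → c p ≡ c q
    c-const {x} p q with iso x
    ... | yes _ = refl
    ... | no h = ⊥-elim (h p)

    lemma : ∀ {x} (p : a ≡ x) → p ≡ trans (sym (c refl)) (c p)
    lemma refl = sym (trans-symˡ (c refl))

  path-unique : ∀ {x} (p q : a ≡ x) → p ≡ q
  path-unique p q =
    trans (lemma p) (trans (cong (trans (sym (c refl))) (c-const p q)) (sym (lemma q)))

private
  Σ-path-snd : {A : Set ℓ} {B : A → Set ℓ'} {a a' : A} {b : B a} {b' : B a'}
    (e : (a , b) ≡ (a' , b')) → subst B (cong proj₁ e) b ≡ b'
  Σ-path-snd refl = refl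

  Σ-path-snd-refl : {A : Set ℓ} {B : A → Set ℓ'} {a : A} → isIsolated a →
    {b b' : B a} → (a , b) ≡ (a , b') → b ≡ b'
  Σ-path-snd-refl {B = B} {a = a} ia {b} e =
    trans (cong (λ q → subst B q b) (LocalHedberg.path-unique ia refl (cong proj₁ e)))
          (Σ-path-snd e)

  Σ-iso-aux : {A : Set ℓ} {B : A → Set ℓ'} {a a' : A} {b : B a} →
    isIsolated a → isIsolated b → (e : a ≡ a') → (b' : B a') →
    Dec ((a , b) ≡ (a' , b'))
  Σ-iso-aux ia ib refl b' with ib b'
  ... | yes refl = yes refl
  ... | no h = no (λ e → h (Σ-path-snd-refl ia e))

Σ-isolated : {A : Set ℓ} {B : A → Set ℓ'} {a : A} {b : B a} →
  isIsolated a → isIsolated b → isIsolated {A = Σ A B} (a , b)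
Σ-isolated ia ib (a' , b') with ia a'
... | yes e = Σ-iso-aux ia ib e b'
... | no h = no (λ e → h (cong proj₁ e))

-- Containers (S ◁ P) are stdlib containers Shape ▷ Position

Discrete : Container ℓ ℓ' → Set (ℓ ⊔ ℓ')
Discrete C = ∀ (s : Shape C) (p q : Position C s) → Dec (p ≡ q)

SetTruncated : Container ℓ ℓ' → Set (ℓ ⊔ ℓ')
SetTruncated C = ((x y : Shape C) (e e' : x ≡ y) → e ≡ e')
               × (∀ s (x y : Position C s) (e e' : x ≡ y) → e ≡ e')

_⊗_ : Container ℓ ℓ → Container ℓ ℓ → Container ℓ ℓ
(S ▷ P) ⊗ (T ▷ Q) = (S × T) ▷ λ { (s , t) → P s ⊎ Q t }

_[_] : Container ℓ ℓ → Container ℓ ℓ → Container ℓ ℓ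
(S ▷ P) [ T ▷ Q ] = (Σ[ s ∈ S ] (P s → T)) ▷ λ { (s , f) → Σ[ p ∈ P s ] Q (f p) }

∂ : Container ℓ ℓ' → Container (ℓ ⊔ ℓ') ℓ'
∂ (S ▷ P) = (Σ[ s ∈ S ] (P s) °) ▷ λ { (s , (p , _)) → P s ∖ p }

graft : {A : Set ℓ} {B : Set ℓ'} (p₀ : A) → isIsolated p₀ →
  (A ∖ p₀ → B) → B → A → B
graft p₀ iso f t p with iso p
... | yes _ = t
... | no h = f (p , h)

graft-p₀ : {A : Set ℓ} {B : Set ℓ'} (p₀ : A) (iso : isIsolated p₀)
  (f : A ∖ p₀ → B) (t : B) → graft p₀ iso f t p₀ ≡ t
graft-p₀ p₀ iso f t with iso p₀
... | yes _ = refl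
... | no h = ⊥-elim (h refl)

subst-isolated : {A : Set ℓ} (Q : A → Set ℓ') {x y : A} (e : x ≡ y) {q : Q x} →
  isIsolated q → isIsolated (subst Q e q)
subst-isolated Q refl i = i

-- Shape map of the lax chain-rule morphism
--   chain_{F,G} : (∂F)[G] × ∂G ⊸ ∂(F[G])

chainShape : (F G : Container ℓ ℓ) →
  Shape (((∂ F) [ G ]) ⊗ (∂ G)) → Shape (∂ (F [ G ]))
chainShape (S ▷ P) (T ▷ Q) (((s , (p₀ , i₀)) , f) , (t , (q₀ , j₀))) =
  (s , g) , ((p₀ , q₀') , Σ-isolated {B = λ p → Q (g p)} i₀ j₀')
  where
    g : P s → T
    g = graft p₀ i₀ f t
    q₀' : Q (g p₀)
    q₀' = subst Q (sym (graft-p₀ p₀ i₀ f t)) q₀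
    j₀' : isIsolated q₀'
    j₀' = subst-isolated Q (sym (graft-p₀ p₀ i₀ f t)) j₀

{-# OPTIONS --safe #-}
module Submission where

-- For an isolated p₀, grafting at p₀ is inverse to restricting g : P s → T to P s ∖ p₀
-- together with evaluating g at p₀.  So chain is inverted by sending (s , g , (p₀ , q₀))
-- to ((s , p₀) , g restricted) , (g p₀ , q₀), where discreteness of F and G is what makes
-- p₀ and q₀ isolated.  Under function extensionality isolation witnesses form a
-- proposition, so both round trips reduce to comparing points and functions.

open import Defs
open import Level using (Level; 0ℓ)
open import Function.Base using (_∘_)
open import Function.Bundles using (mk↔ₛ′)
open import Function.Properties.Inverse.HalfAdjointEquivalence using (_≃_; ↔⇒≃)
open import Axiom.Extensionality.Propositional
  using (Extensionality; lower-extensionality)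
open import Data.Container.Core using (Container; Shape)
open import Data.Product using (Σ; _,_; proj₁; proj₂)
open import Data.Empty using (⊥-elim)
open import Relation.Nullary using (¬_; Dec; yes; no)
open import Relation.Nullary.Irrelevant using (Irrelevant)
open import Relation.Binary.PropositionalEquality
  using (_≡_; refl; sym; cong; cong₂; subst; subst-subst-sym; module ≡-Reasoning)

private variable a b c : Level

¬-irrelevant : Extensionality a 0ℓ → {A : Set a} → Irrelevant (¬ A)
¬-irrelevant fe h h' = fe (λ x → ⊥-elim (h x))

Dec-irrelevant : Extensionality a 0ℓ → {A : Set a} → Irrelevant A → Irrelevant (Dec A)
Dec-irrelevant fe irr (yes x) (yes y) = cong yes (irr x y)
Dec-irrelevant fe irr (yes x) (no ¬y) = ⊥-elim (¬y x)
Dec-irrelevant fe irr (no ¬x) (yes y) = ⊥-elim (¬x y)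
Dec-irrelevant fe irr (no ¬x) (no ¬y) = cong no (¬-irrelevant fe ¬x ¬y)

isIsolated-irrelevant : Extensionality a a → {A : Set a} {x : A} → Irrelevant (isIsolated x)
isIsolated-irrelevant {a} fe i j =
  fe λ y → Dec-irrelevant (lower-extensionality a a fe) (LocalHedberg.path-unique i) (i y) (j y)

-- Extensionality has no computation rule relating  fe H  back to  H , so paths
-- out of a homotopy are built by this induction principle rather than by transport along  fe H .
homotopy-induction : Extensionality a b → {A : Set a} {B : A → Set b} (g : (x : A) → B x) →
  (M : (g' : (x : A) → B x) → (∀ x → g' x ≡ g x) → Set c) →
  M g (λ _ → refl) → ∀ g' H → M g' H
homotopy-induction fe {A} {B} g M m g' H =
  subst (λ (g' , H) → M g' H) (cong unzip (fe λ x → singleton-centre (g' x , H x))) m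
  where
  singleton-centre : ∀ {x} (k : Σ (B x) (_≡ g x)) → (g x , refl) ≡ k
  singleton-centre (_ , refl) = refl

  unzip : ((x : A) → Σ (B x) (_≡ g x)) → Σ ((x : A) → B x) (λ g' → ∀ x → g' x ≡ g x)
  unzip k = (λ x → proj₁ (k x)) , (λ x → proj₂ (k x))

≃⇒isEquiv : {A : Set a} {B : Set b} (e : A ≃ B) → isEquiv (_≃_.to e)
≃⇒isEquiv e y = (from y , right-inverse-of y) , λ (x , p) → centre-≡ x y p
  where
  open _≃_ e

  adjust : ∀ {x x'} (u : x ≡ x') (r : to x ≡ to x') → cong to u ≡ r →
    _≡_ {A = fiber to (to x')} (x , r) (x' , refl)
  adjust refl .refl refl = refl

  centre-≡ : ∀ x y (p : to x ≡ y) → _≡_ {A = fiber to y} (from y , right-inverse-of y) (x , p)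
  centre-≡ x .(to x) refl = adjust (left-inverse-of x) (right-inverse-of (to x)) (left-right x)

module _ {A : Set a} {B : Set b} {p₀ : A} (i : isIsolated p₀) where

  graft-off-p₀ : Extensionality a 0ℓ → (f : A ∖ p₀ → B) (t : B) (p : A ∖ p₀) →
    graft p₀ i f t (proj₁ p) ≡ f p
  graft-off-p₀ fe f t (p , h) with i p
  ... | yes e = ⊥-elim (h e)
  ... | no h' = cong (λ h → f (p , h)) (¬-irrelevant fe h' h)

  graft-restrict : (g : A → B) (p : A) → graft p₀ i (g ∘ proj₁) (g p₀) p ≡ g p
  graft-restrict g p with i p
  ... | yes e = cong g e
  ... | no _ = refl

  graft-restrict-p₀ : (g : A → B) → graft-restrict g p₀ ≡ graft-p₀ p₀ i (g ∘ proj₁) (g p₀)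
  graft-restrict-p₀ g with i p₀
  ... | yes e = cong (cong g) (LocalHedberg.path-unique i e refl)
  ... | no h = ⊥-elim (h refl)

Σ°-subst-sym-≡ : Extensionality b b → {T : Set a} (Q : T → Set b) {x t : T} (e : x ≡ t)
  (q : Q t) (j : isIsolated (subst Q (sym e) q)) (j' : isIsolated q) →
  _≡_ {A = Σ T (λ t → Q t °)} (x , (subst Q (sym e) q , j)) (t , (q , j'))
Σ°-subst-sym-≡ fe Q refl q j j' = cong (λ j → _ , (q , j)) (isIsolated-irrelevant fe j j')

module ChainRule {ℓ : Level} (fe : Extensionality ℓ ℓ)
  (F G : Container ℓ ℓ) (dF : Discrete F) (dG : Discrete G) where

  open Container F using () renaming (Position to P)
  open Container G using () renaming (Shape to T; Position to Q)

  unchainShape : Shape (∂ (F [ G ])) → Shape (((∂ F) [ G ]) ⊗ (∂ G))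
  unchainShape ((s , g) , ((p₀ , q₀) , _)) =
    ((s , (p₀ , dF s p₀)) , g ∘ proj₁) , (g p₀ , (q₀ , dG (g p₀) q₀))

  unchain-chain : ∀ x → unchainShape (chainShape F G x) ≡ x
  unchain-chain (((s , (p₀ , i₀)) , f) , (t , (q₀ , j₀))) =
    cong₂ _,_
      (cong₂ (λ i f → (s , (p₀ , i)) , f)
        (isIsolated-irrelevant fe _ _)
        (fe (graft-off-p₀ i₀ (lower-extensionality ℓ ℓ fe) f t)))
      (Σ°-subst-sym-≡ fe Q (graft-p₀ p₀ i₀ f t) q₀ _ _)

  ∂[]-shape-≡ : ∀ {s} {g g' : P s → T} (H : ∀ p → g' p ≡ g p) {p₀}
    {q : Q (g' p₀)} {q₀ : Q (g p₀)} → subst Q (H p₀) q ≡ q₀ → ∀ k' k →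
    _≡_ {A = Shape (∂ (F [ G ]))} ((s , g') , ((p₀ , q) , k')) ((s , g) , ((p₀ , q₀) , k))
  ∂[]-shape-≡ {s} {g} {g'} H {p₀} {q₀ = q₀} =
    homotopy-induction fe g
      (λ g' H → ∀ {q} → subst Q (H p₀) q ≡ q₀ → ∀ k' k →
        _≡_ {A = Shape (∂ (F [ G ]))} ((s , g') , ((p₀ , q) , k')) ((s , g) , ((p₀ , q₀) , k)))
      (λ { refl k' k → cong (λ k → (s , g) , ((p₀ , q₀) , k)) (isIsolated-irrelevant fe k' k) })
      g' H

  chain-unchain : ∀ y → chainShape F G (unchainShape y) ≡ y
  chain-unchain ((s , g) , ((p₀ , q₀) , k)) =
    ∂[]-shape-≡ (graft-restrict i g) transports-q₀ _ k
    where
    open ≡-Reasoning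
    i : isIsolated p₀
    i = dF s p₀

    e : graft p₀ i (g ∘ proj₁) (g p₀) p₀ ≡ g p₀
    e = graft-p₀ p₀ i (g ∘ proj₁) (g p₀)

    transports-q₀ : subst Q (graft-restrict i g p₀) (subst Q (sym e) q₀) ≡ q₀
    transports-q₀ = begin
      subst Q (graft-restrict i g p₀) (subst Q (sym e) q₀)
        ≡⟨ cong (λ e' → subst Q e' (subst Q (sym e) q₀)) (graft-restrict-p₀ i g) ⟩
      subst Q e (subst Q (sym e) q₀)
        ≡⟨ subst-subst-sym e ⟩
      q₀ ∎

  chainShape-isEquiv : isEquiv (chainShape F G)
  chainShape-isEquiv =
    ≃⇒isEquiv (↔⇒≃ (mk↔ₛ′ (chainShape F G) unchainShape chain-unchain unchain-chain))

theorem4p5 : {ℓ : Level} → Extensionality ℓ ℓ →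
    (F G : Container ℓ ℓ) → Discrete F → Discrete G →
    isEquiv (chainShape F G)
theorem4p5 fe F G dF dG = ChainRule.chainShape-isEquiv fe F G dF dG
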